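{- Let $n$ be a positive integer, let $\mathcal{A}\subseteq 2^{[n]}$ be an antichain and let $\mathcal{F}\subseteq 2^{[n]}$ be a flat antichain with $|\mathcal{F}|=|\mathcal{A}|$ and $V(\mathcal{F})=V(\mathcal{A})$. Then $\sum_{F\in\mathcal{F}}1/\binom{n}{|F|}\le \sum_{A\in\mathcal{A}}1/\binom{n}{|A|}$. In other words, flat antichains have minimum BLYM value among all antichains in $2^{[n]}$ with the same size and volume.
   Context: $[n]=\{1,\dots,n\}$. An antichain in $2^{[n]}$ is a family of subsets of $[n]$ none of which is properly contained in another. An antichain $\mathcal{F}$ is flat if there is $1\le k\le n$ with $|F|\in\{k-1,k\}$ for all $F\in\mathcal{F}$. The volume of $\mathcal{F}$ is $V(\mathcal{F})=\sum_{F\in\mathcal{F}}|F|$. The BLYM value of $\mathcal{F}$ is $\sum_{F\in\mathcal{F}}1/\binom{n}{|F|}$. -}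

module Defs where

open import Data.Nat using (ℕ; zero; suc; _+_; _∸_; _≤_)
open import Data.Nat.Combinatorics using (_C_)
open import Data.Fin.Subset using (Subset; _⊆_; ∣_∣)
open import Data.List using (List; []; _∷_; length)
open import Data.List.Membership.Propositional using (_∈_)
open import Data.List.Relation.Unary.Unique.Propositional using (Unique)
open import Data.Product using (Σ; _×_)
open import Data.Sum using (_⊎_)
open import Data.Integer using (+_)
open import Data.Rational as ℚ using (ℚ)
open import Relation.Binary.PropositionalEquality using (_≡_)

Family : ℕ → Set
Family n = List (Subset n)

IsFamily : ∀ {n} → Family n → Set
IsFamily 𝓕 = Unique 𝓕

IsAntichain : ∀ {n} → Family n → Set
IsAntichain 𝓕 = ∀ A B → A ∈ 𝓕 → B ∈ 𝓕 → A ⊆ B → A ≡ B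

IsFlat : ∀ {n} → Family n → Set
IsFlat {n} 𝓕 = Σ ℕ λ k → (1 ≤ k) × (k ≤ n) ×
  (∀ F → F ∈ 𝓕 → (∣ F ∣ ≡ k ∸ 1) ⊎ (∣ F ∣ ≡ k))

volume : ∀ {n} → Family n → ℕ
volume [] = 0
volume (F ∷ 𝓕) = ∣ F ∣ + volume 𝓕

-- 1/m as a rational (m = 0 never occurs below, since C(n,|F|) ≥ 1).
inv : ℕ → ℚ
inv zero = ℚ.0ℚ
inv (suc m) = (+ 1) ℚ./ suc m

blym : ∀ {n} → Family n → ℚ
blym [] = ℚ.0ℚ
blym {n} (F ∷ 𝓕) = inv (n C ∣ F ∣) ℚ.+ blym 𝓕

-- s ↦ 1 / C(n, s) is convex on {0, …, n}: by the absorption identity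
-- C(n,s)(n − s) = C(n,s+1)(s+1), the binomial C(n,s+1) dominates the harmonic
-- mean of its neighbours. Hence s ↦ 1 / C(n, s) lies above the line through its
-- values at k − 1 and k, and a flat family with levels k − 1, k lies on that line.
-- Summing an affine function of |F| over a family only sees the size and the
-- volume of the family, so the flat family has the smaller BLYM value.
module Submission where

open import Defs
open import Data.Nat using (ℕ; NonZero)
open import Data.List using (length)
open import Data.Rational using (_≤_)
open import Relation.Binary.PropositionalEquality using (_≡_)

open import Data.Nat as Nat using (zero; suc; _<_; z≤n; s≤s)
import Data.Nat.Properties as ℕP
open import Data.Nat.Combinatorics using (_C_; nCk+nC[k+1]≡[n+1]C[k+1]; k>n⇒nCk≡0; nC1≡n)
open import Data.Integer as ℤ using (+_)
import Data.Integer.Properties as ℤP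
open import Data.Rational as ℚ using (ℚ)
import Data.Rational.Properties as ℚP
open import Data.Rational.Unnormalised as ℚᵘ using (mkℚᵘ)
import Data.Rational.Unnormalised.Properties as ℚᵘP
open import Algebra.Properties.Monoid.Mult ℚP.+-0-monoid using (_×_; ×-homo-+)
open import Data.List using ([]; _∷_)
open import Data.List.Relation.Unary.Any using (here; there)
open import Data.List.Membership.Propositional using (_∈_)
open import Data.Fin.Subset using (∣_∣)
open import Data.Fin.Subset.Properties using (∣p∣≤n)
open import Data.Product using (_,_)
open import Data.Sum using (inj₁; inj₂)
open import Relation.Binary.PropositionalEquality using (refl; sym; trans; cong; cong₂; subst; module ≡-Reasoning)
open import Relation.Nullary using (yes; no)
open import Function using (_∘_)
open import Algebra.Bundles using (CommutativeMonoid)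

module _ where
  open Nat using (_+_; _*_; _∸_)
  open ℕP using (module ≤-Reasoning)

  nCk*[n∸k]≡nC[k+1]*[k+1] : ∀ n k → (n C k) * (n ∸ k) ≡ (n C suc k) * suc k
  nCk*[n∸k]≡nC[k+1]*[k+1] zero k =
    trans (cong ((0 C k) *_) (ℕP.0∸n≡0 k)) (ℕP.*-zeroʳ (0 C k))
  nCk*[n∸k]≡nC[k+1]*[k+1] (suc n) zero =
    trans (ℕP.+-identityʳ (suc n)) (sym (trans (ℕP.*-identityʳ _) (nC1≡n (suc n))))
  nCk*[n∸k]≡nC[k+1]*[k+1] (suc n) (suc k) with k Nat.<? n
  ... | no k≮n = begin
      (suc n C suc k) * (n ∸ k)    ≡⟨ cong ((suc n C suc k) *_) (ℕP.m≤n⇒m∸n≡0 n≤k) ⟩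
      (suc n C suc k) * 0          ≡⟨ ℕP.*-zeroʳ (suc n C suc k) ⟩
      0 * suc (suc k)              ≡⟨ cong (_* suc (suc k)) (k>n⇒nCk≡0 (s≤s (s≤s n≤k))) ⟨
      (suc n C suc (suc k)) * suc (suc k) ∎
    where
    open ≡-Reasoning
    n≤k = ℕP.≮⇒≥ k≮n
  ... | yes k<n = begin
      (suc n C suc k) * (n ∸ k)
        ≡⟨ cong₂ _*_ (nCk+nC[k+1]≡[n+1]C[k+1] n k) (sym n∸k≡1+r) ⟨
      (x + y) * suc r
        ≡⟨ solve 3 (λ x y r → (x :+ y) :* (con 1 :+ r) := x :* (con 1 :+ r) :+ y :* r :+ y) refl x y r ⟩
      x * suc r + y * r + y
        ≡⟨ cong₂ (λ p q → p + q + y) absorb-k (nCk*[n∸k]≡nC[k+1]*[k+1] n (suc k)) ⟩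
      y * suc k + z * suc (suc k) + y
        ≡⟨ solve 3 (λ y z k → y :* (con 1 :+ k) :+ z :* (con 2 :+ k) :+ y := (y :+ z) :* (con 2 :+ k)) refl y z k ⟩
      (y + z) * suc (suc k)
        ≡⟨ cong (_* suc (suc k)) (nCk+nC[k+1]≡[n+1]C[k+1] n (suc k)) ⟩
      (suc n C suc (suc k)) * suc (suc k) ∎
    where
    open ≡-Reasoning
    open import Data.Nat.Solver using (module +-*-Solver)
    open +-*-Solver
    x = n C k
    y = n C suc k
    z = n C suc (suc k)
    r = n ∸ suc k
    n∸k≡1+r : n ∸ k ≡ suc r
    n∸k≡1+r = ℕP.+-∸-assoc 1 k<n
    absorb-k : x * suc r ≡ y * suc k
    absorb-k = trans (cong (x *_) (sym n∸k≡1+r)) (nCk*[n∸k]≡nC[k+1]*[k+1] n k)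

  nCk>0 : ∀ {n k} → k Nat.≤ n → 0 < n C k
  nCk>0 {k = zero} _ = s≤s z≤n
  nCk>0 {suc n} {suc k} (s≤s k≤n) =
    subst (0 <_) (nCk+nC[k+1]≡[n+1]C[k+1] n k) (ℕP.<-≤-trans (nCk>0 k≤n) (ℕP.m≤m+n _ _))

  2*m*n≤m*m+n*n : ∀ m n → 2 * m * n Nat.≤ m * m + n * n
  2*m*n≤m*m+n*n zero n = z≤n
  2*m*n≤m*m+n*n (suc m) zero rewrite ℕP.*-zeroʳ (2 * suc m) = z≤n
  2*m*n≤m*m+n*n (suc m) (suc n) = begin
      2 * suc m * suc n                   ≡⟨ solve (m ∷ n ∷ []) ⟩
      2 * m * n + (2 * m + 2 * n + 2)     ≤⟨ ℕP.+-monoˡ-≤ _ (2*m*n≤m*m+n*n m n) ⟩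
      m * m + n * n + (2 * m + 2 * n + 2) ≡⟨ solve (m ∷ n ∷ []) ⟩
      suc m * suc m + suc n * suc n       ∎
    where
    open ≤-Reasoning
    open import Data.Nat.Tactic.RingSolver using (solve)

  -- With a, c, b = C(n,j), C(n,j+1), C(n,j+2), x = j+1 and y = n−j−1, the two
  -- hypotheses are instances of the absorption identity.
  2*a*b≤c*[a+b] : ∀ {a b c x y} → a * suc y ≡ c * x → c * y ≡ b * suc x →
                  2 * a * b Nat.≤ c * (a + b)
  2*a*b≤c*[a+b] {a} {b} {c} {x} {y} ay≡cx cy≡bx = ℕP.*-cancelʳ-≤ _ _ (suc y * suc x) (begin
      2 * a * b * (suc y * suc x)         ≡⟨ solve (a ∷ b ∷ x ∷ y ∷ []) ⟩
      2 * (a * suc y) * (b * suc x)       ≡⟨ cong₂ (λ p q → 2 * p * q) ay≡cx (sym cy≡bx) ⟩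
      2 * (c * x) * (c * y)               ≡⟨ solve (c ∷ x ∷ y ∷ []) ⟩
      c * c * (2 * x * y)                 ≤⟨ ℕP.*-monoʳ-≤ (c * c) (2*m*n≤m*m+n*n x y) ⟩
      c * c * (x * x + y * y)             ≤⟨ ℕP.*-monoʳ-≤ (c * c) (ℕP.+-mono-≤ (m*m≤m*[1+m] x) (m*m≤m*[1+m] y)) ⟩
      c * c * (x * suc x + y * suc y)     ≡⟨ solve (c ∷ x ∷ y ∷ []) ⟩
      c * (c * x * suc x + c * y * suc y) ≡⟨ cong₂ (λ p q → c * (p * suc x + q * suc y)) ay≡cx (sym cy≡bx) ⟨
      c * (a * suc y * suc x + b * suc x * suc y) ≡⟨ solve (a ∷ b ∷ c ∷ x ∷ y ∷ []) ⟩
      c * (a + b) * (suc y * suc x)       ∎)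
    where
    open ≤-Reasoning
    open import Data.Nat.Tactic.RingSolver using (solve)
    m*m≤m*[1+m] : ∀ m → m * m Nat.≤ m * suc m
    m*m≤m*[1+m] m = ℕP.*-monoʳ-≤ m (ℕP.n≤1+n m)

module _ where
  open ℤ using (ℤ; _*_; _+_; _-_; -_; +≤+)

  -- Stated in the shape in which ℚᵘ computes the cross-multiplied numerators
  -- of 1/c − 1/a and 1/b − 1/c, so that it applies to them by computation.
  cross-difference : ∀ (a b c : ℤ) →
    (+ 1 * a + - + 1 * c) * (b * c) - (+ 1 * c + - + 1 * b) * (c * a) ≡ + 2 * a * b * c - c * (a + b) * c
  cross-difference = solve-∀
    where open import Data.Integer.Tactic.RingSolver using (solve-∀)

  inv-convexᵘ : ∀ a b c → 2 Nat.* suc a Nat.* suc b Nat.≤ suc c Nat.* (suc a Nat.+ suc b) →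
                mkℚᵘ (+ 1) c ℚᵘ.- mkℚᵘ (+ 1) a ℚᵘ.≤ mkℚᵘ (+ 1) b ℚᵘ.- mkℚᵘ (+ 1) c
  inv-convexᵘ a b c h = ℚᵘ.*≤* (ℤP.i-j≤0⇒i≤j (subst (ℤ._≤ ℤ.0ℤ)
    (sym (cross-difference (+ suc a) (+ suc b) (+ suc c)))
    (ℤP.i≤j⇒i-j≤0 (+≤+ (ℕP.*-monoˡ-≤ (suc c) h)))))

module _ where
  open import Data.Rational using (_+_; _-_)
  open import Data.Rational.Solver using (module +-*-Solver)
  open +-*-Solver
  open import Algebra.Properties.Group ℚP.+-0-group using (//-rightDividesˡ; //-rightDividesʳ)
  open import Algebra.Properties.CommutativeSemigroup
    (CommutativeMonoid.commutativeSemigroup ℚP.+-0-commutativeMonoid) using (x∙yz≈y∙xz; interchange)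

  inv-convex : ∀ {a b c} → 0 < a → 0 < b → 0 < c → 2 Nat.* a Nat.* b Nat.≤ c Nat.* (a Nat.+ b) →
               inv c - inv a ≤ inv b - inv c
  inv-convex {suc a} {suc b} {suc c} _ _ _ h = ℚP.toℚᵘ-cancel-≤ (begin
      ℚ.toℚᵘ (inv (suc c) - inv (suc a))   ≃⟨ toℚᵘ-inv-inv c a ⟩
      mkℚᵘ (+ 1) c ℚᵘ.- mkℚᵘ (+ 1) a       ≤⟨ inv-convexᵘ a b c h ⟩
      mkℚᵘ (+ 1) b ℚᵘ.- mkℚᵘ (+ 1) c       ≃⟨ toℚᵘ-inv-inv b c ⟨
      ℚ.toℚᵘ (inv (suc b) - inv (suc c))   ∎)
    where
    open ℚᵘP.≤-Reasoning
    toℚᵘ-inv : ∀ m → ℚ.toℚᵘ (inv (suc m)) ℚᵘ.≃ mkℚᵘ (+ 1) m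
    toℚᵘ-inv m = ℚP.toℚᵘ-fromℚᵘ (mkℚᵘ (+ 1) m)
    toℚᵘ-inv-inv : ∀ m k → ℚ.toℚᵘ (inv (suc m) - inv (suc k)) ℚᵘ.≃ mkℚᵘ (+ 1) m ℚᵘ.- mkℚᵘ (+ 1) k
    toℚᵘ-inv-inv m k = ℚᵘP.≃-trans (ℚP.toℚᵘ-homo-+ (inv (suc m)) (ℚ.- inv (suc k)))
      (ℚᵘP.+-cong (toℚᵘ-inv m) (ℚᵘP.≃-trans (ℚP.toℚᵘ-homo‿- (inv (suc k))) (ℚᵘP.-‿cong (toℚᵘ-inv k))))

  Δ : (ℕ → ℚ) → ℕ → ℚ
  Δ g j = g (suc j) - g j

  ConvexOn : ℕ → (ℕ → ℚ) → Set
  ConvexOn n g = ∀ j → 2 Nat.+ j Nat.≤ n → Δ g j ≤ Δ g (suc j)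

  reciprocalBinomial : ℕ → ℕ → ℚ
  reciprocalBinomial n s = inv (n C s)

  reciprocalBinomial-convex : ∀ n → ConvexOn n (reciprocalBinomial n)
  reciprocalBinomial-convex n j 2+j≤n =
    inv-convex (nCk>0 (ℕP.≤-trans (ℕP.n≤1+n j) j<n)) (nCk>0 2+j≤n) (nCk>0 j<n)
      (2*a*b≤c*[a+b] {n C j} {n C suc (suc j)} {n C suc j} absorb-j absorb-1+j)
    where
    j<n : suc j Nat.≤ n
    j<n = ℕP.<⇒≤ 2+j≤n
    absorb-j : (n C j) Nat.* suc (n Nat.∸ suc j) ≡ (n C suc j) Nat.* suc j
    absorb-j = trans (cong ((n C j) Nat.*_) (sym (ℕP.+-∸-assoc 1 j<n))) (nCk*[n∸k]≡nC[k+1]*[k+1] n j)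
    absorb-1+j : (n C suc j) Nat.* (n Nat.∸ suc j) ≡ (n C suc (suc j)) Nat.* suc (suc j)
    absorb-1+j = nCk*[n∸k]≡nC[k+1]*[k+1] n (suc j)

  Δ-mono : ∀ {n} g → ConvexOn n g → ∀ {i j} → i Nat.≤ j → suc j Nat.≤ n → Δ g i ≤ Δ g j
  Δ-mono {n} g convex {i} i≤j = Δ-mono-+ _ (ℕP.m∸n+n≡m i≤j)
    where
    Δ-mono-+ : ∀ k {j} → k Nat.+ i ≡ j → suc j Nat.≤ n → Δ g i ≤ Δ g j
    Δ-mono-+ zero    refl _  = ℚP.≤-refl
    Δ-mono-+ (suc k) refl le = ℚP.≤-trans (Δ-mono-+ k refl (ℕP.<⇒≤ le)) (convex (k Nat.+ i) le)

  g[s]+k×d≤g[k+s] : ∀ g {d s} k → (∀ i → i < k → d ≤ Δ g (i Nat.+ s)) → g s + k × d ≤ g (k Nat.+ s)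
  g[s]+k×d≤g[k+s] _ zero _ = ℚP.≤-reflexive (ℚP.+-identityʳ _)
  g[s]+k×d≤g[k+s] g {d} {s} (suc k) d≤Δ = begin
      g s + (d + k × d)                 ≡⟨ x∙yz≈y∙xz (g s) d (k × d) ⟩
      d + (g s + k × d)                 ≤⟨ ℚP.+-mono-≤ (d≤Δ k (ℕP.n<1+n k)) (g[s]+k×d≤g[k+s] g k d≤Δ′) ⟩
      Δ g (k Nat.+ s) + g (k Nat.+ s)   ≡⟨ //-rightDividesˡ (g (k Nat.+ s)) (g (suc k Nat.+ s)) ⟩
      g (suc k Nat.+ s)                 ∎
    where
    open ℚP.≤-Reasoning
    d≤Δ′ : ∀ i → i < k → d ≤ Δ g (i Nat.+ s)
    d≤Δ′ i = d≤Δ i ∘ ℕP.m<n⇒m<1+n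

  g[k+s]≤g[s]+k×d : ∀ g {d s} k → (∀ i → i < k → Δ g (i Nat.+ s) ≤ d) → g (k Nat.+ s) ≤ g s + k × d
  g[k+s]≤g[s]+k×d _ zero _ = ℚP.≤-reflexive (sym (ℚP.+-identityʳ _))
  g[k+s]≤g[s]+k×d g {d} {s} (suc k) Δ≤d = begin
      g (suc k Nat.+ s)                 ≡⟨ //-rightDividesˡ (g (k Nat.+ s)) (g (suc k Nat.+ s)) ⟨
      Δ g (k Nat.+ s) + g (k Nat.+ s)   ≤⟨ ℚP.+-mono-≤ (Δ≤d k (ℕP.n<1+n k)) (g[k+s]≤g[s]+k×d g k Δ≤d′) ⟩
      d + (g s + k × d)                 ≡⟨ x∙yz≈y∙xz d (g s) (k × d) ⟩
      g s + (d + k × d)                 ∎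
    where
    open ℚP.≤-Reasoning
    Δ≤d′ : ∀ i → i < k → Δ g (i Nat.+ s) ≤ d
    Δ≤d′ i = Δ≤d i ∘ ℕP.m<n⇒m<1+n

  chord : (ℕ → ℚ) → ℕ → ℕ → ℚ
  chord g c s = (g c - c × Δ g c) + s × Δ g c

  chord-≤-right : ∀ {n} g {c s} → ConvexOn n g → ∀ k → k Nat.+ c ≡ s → s Nat.≤ n → chord g c s ≤ g s
  chord-≤-right g {c} convex k refl k+c≤n = begin
      (g c - c × d) + (k Nat.+ c) × d
        ≡⟨ cong (λ t → (g c - c × d) + t) (×-homo-+ d k c) ⟩
      (g c - c × d) + (k × d + c × d)
        ≡⟨ solve 3 (λ x m l → (x :- l) :+ (m :+ l) := x :+ m) refl (g c) (k × d) (c × d) ⟩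
      g c + k × d
        ≤⟨ g[s]+k×d≤g[k+s] g k d≤Δ ⟩
      g (k Nat.+ c) ∎
    where
    open ℚP.≤-Reasoning
    d = Δ g c
    d≤Δ : ∀ i → i < k → d ≤ Δ g (i Nat.+ c)
    d≤Δ i i<k = Δ-mono g convex (ℕP.m≤n+m c i) (ℕP.≤-trans (ℕP.+-monoˡ-≤ c i<k) k+c≤n)

  chord-≤-left : ∀ {n} g {c s} → ConvexOn n g → suc c Nat.≤ n → ∀ k → k Nat.+ s ≡ c → chord g c s ≤ g s
  chord-≤-left g {s = s} convex c<n k refl = begin
      (g (k Nat.+ s) - (k Nat.+ s) × d) + s × d
        ≡⟨ cong (λ t → (g (k Nat.+ s) - t) + s × d) (×-homo-+ d k s) ⟩
      (g (k Nat.+ s) - (k × d + s × d)) + s × d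
        ≡⟨ solve 3 (λ x m l → (x :- (m :+ l)) :+ l := x :- m) refl (g (k Nat.+ s)) (k × d) (s × d) ⟩
      g (k Nat.+ s) - k × d
        ≤⟨ ℚP.+-monoˡ-≤ (ℚ.- (k × d)) (g[k+s]≤g[s]+k×d g k Δ≤d) ⟩
      (g s + k × d) - k × d
        ≡⟨ //-rightDividesʳ (k × d) (g s) ⟩
      g s ∎
    where
    open ℚP.≤-Reasoning
    d = Δ g (k Nat.+ s)
    Δ≤d : ∀ i → i < k → Δ g (i Nat.+ s) ≤ d
    Δ≤d i i<k = Δ-mono g convex (ℕP.+-monoˡ-≤ s (ℕP.<⇒≤ i<k)) c<n

  chord-≤ : ∀ {n} g {c s} → ConvexOn n g → suc c Nat.≤ n → s Nat.≤ n → chord g c s ≤ g s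
  chord-≤ g {c} {s} convex c<n s≤n with ℕP.≤-total c s
  ... | inj₁ c≤s = chord-≤-right g convex (s Nat.∸ c) (ℕP.m∸n+n≡m c≤s) s≤n
  ... | inj₂ s≤c = chord-≤-left g convex c<n (c Nat.∸ s) (ℕP.m∸n+n≡m s≤c)

  chord-at-c : ∀ g c → chord g c c ≡ g c
  chord-at-c g c = //-rightDividesˡ (c × Δ g c) (g c)

  chord-at-suc : ∀ g c → chord g c (suc c) ≡ g (suc c)
  chord-at-suc g c = solve 3 (λ x y l → (x :- l) :+ ((y :- x) :+ l) := y) refl (g c) (g (suc c)) (c × Δ g c)

  affine-sum-∷ : ∀ a d l s v → suc l × a + (s Nat.+ v) × d ≡ (a + s × d) + (l × a + v × d)
  affine-sum-∷ a d l s v =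
    trans (cong (λ t → suc l × a + t) (×-homo-+ d s v)) (interchange a (l × a) (s × d) (v × d))

  blym-≥-affine : ∀ {n} a d → (∀ s → s Nat.≤ n → a + s × d ≤ reciprocalBinomial n s) →
                  (𝓐 : Family n) → length 𝓐 × a + volume 𝓐 × d ≤ blym 𝓐
  blym-≥-affine a d below [] = ℚP.≤-refl
  blym-≥-affine a d below (A ∷ 𝓐) = ℚP.≤-trans
    (ℚP.≤-reflexive (affine-sum-∷ a d (length 𝓐) ∣ A ∣ (volume 𝓐)))
    (ℚP.+-mono-≤ (below ∣ A ∣ (∣p∣≤n A)) (blym-≥-affine a d below 𝓐))

  blym-≡-affine : ∀ {n} a d (𝓕 : Family n) →
                  (∀ F → F ∈ 𝓕 → a + ∣ F ∣ × d ≡ reciprocalBinomial n ∣ F ∣) →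
                  length 𝓕 × a + volume 𝓕 × d ≡ blym 𝓕
  blym-≡-affine a d [] on = refl
  blym-≡-affine a d (F ∷ 𝓕) on = trans
    (affine-sum-∷ a d (length 𝓕) ∣ F ∣ (volume 𝓕))
    (cong₂ _+_ (on F (here refl)) (blym-≡-affine a d 𝓕 (λ G G∈𝓕 → on G (there G∈𝓕))))

corollary3 : (n : ℕ) → .{{_ : NonZero n}} → (𝓐 𝓕 : Family n) →
    IsFamily 𝓐 → IsAntichain 𝓐 →
    IsFamily 𝓕 → IsAntichain 𝓕 → IsFlat 𝓕 →
    length 𝓕 ≡ length 𝓐 → volume 𝓕 ≡ volume 𝓐 →
    blym 𝓕 ≤ blym 𝓐
corollary3 n 𝓐 𝓕 _ _ _ _ (zero , () , _)
corollary3 n 𝓐 𝓕 _ _ _ _ (suc c , _ , c<n , levels) |𝓕|≡|𝓐| V𝓕≡V𝓐 = begin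
    blym 𝓕                          ≡⟨ blym-≡-affine a d 𝓕 on-chord ⟨
    length 𝓕 × a + volume 𝓕 × d     ≡⟨ cong₂ (λ l v → l × a + v × d) |𝓕|≡|𝓐| V𝓕≡V𝓐 ⟩
    length 𝓐 × a + volume 𝓐 × d     ≤⟨ blym-≥-affine a d (λ s → chord-≤ f (reciprocalBinomial-convex n) c<n) 𝓐 ⟩
    blym 𝓐                          ∎
  where
  open ℚP.≤-Reasoning
  open import Data.Rational using (_+_; _-_)
  f = reciprocalBinomial n
  d = Δ f c
  a = f c - c × d
  on-chord : ∀ F → F ∈ 𝓕 → chord f c ∣ F ∣ ≡ f ∣ F ∣
  on-chord F F∈𝓕 with levels F F∈𝓕
  ... | inj₁ |F|≡c rewrite |F|≡c = chord-at-c f c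
  ... | inj₂ |F|≡1+c rewrite |F|≡1+c = chord-at-suc f c
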